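{- Let $m\ge2$, let $X$ and $f$ be the two-digit base-$m$ Kaprekar system, and let $r\ge0$ be the integer with $2^r\mid m+1$ and $2^{r+1}\nmid m+1$. Then every $x\in X$ enters its fixed set within $r+2$ steps, i.e. $S(x)\le r+2$.
   Context: $X=\{0,1,\dots,m^2-1\}$, each element written with exactly two base-$m$ digits $x=d_1m+d_0$ (leading zeros allowed). The map is $f(x)=\big(m\max(d_0,d_1)+\min(d_0,d_1)\big)-\big(m\min(d_0,d_1)+\max(d_0,d_1)\big)$. Iterates: $f^0=\mathrm{id}$ and $f^t=f\circ f^{t-1}$. For $x\in X$, the step $S(x)$ is the least $s\ge0$ such that $f^{s+t}(x)=f^s(x)$ for some $t\ge1$. -}

module Defs where

open import Data.Nat using (ℕ; zero; suc; _+_; _*_; _∸_; _≤_; _<_; NonZero)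
open import Data.Nat.DivMod using (_/_; _%_)
open import Data.Nat using (_⊔_; _⊓_)
open import Data.Product using (Σ; _×_)
open import Relation.Binary.PropositionalEquality using (_≡_)
open import Relation.Nullary using (¬_)

digit1 : (m : ℕ) .{{_ : NonZero m}} → ℕ → ℕ
digit1 m x = x / m

digit0 : (m : ℕ) .{{_ : NonZero m}} → ℕ → ℕ
digit0 m x = x % m

-- the two-digit base-m Kaprekar map:
-- f(x) = (m·max(d₀,d₁) + min(d₀,d₁)) − (m·min(d₀,d₁) + max(d₀,d₁))
-- (the difference is always ≥ 0, so truncated subtraction is exact)
kap : (m : ℕ) .{{_ : NonZero m}} → ℕ → ℕ
kap m x =
  (m * (digit0 m x ⊔ digit1 m x) + (digit0 m x ⊓ digit1 m x))
  ∸ (m * (digit0 m x ⊓ digit1 m x) + (digit0 m x ⊔ digit1 m x))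

iter : (ℕ → ℕ) → ℕ → ℕ → ℕ
iter f zero x = x
iter f (suc t) x = f (iter f t x)

Periodic : (ℕ → ℕ) → ℕ → ℕ → Set
Periodic f x s = Σ ℕ (λ t → (1 ≤ t) × (iter f (s + t) x ≡ iter f s x))

IsStep : (ℕ → ℕ) → ℕ → ℕ → Set
IsStep f x s = Periodic f x s × ((s' : ℕ) → s' < s → ¬ Periodic f x s')

{-# OPTIONS --safe #-}
-- Write m = b + 1 and m + 1 = (2Q + 1)·2^r. The Kaprekar map sends x to b·k with k the gap
-- between its digits, and on the multiples b·k (k ≤ b) it acts as the tent map
-- k ↦ |m + 1 − 2k| (with 0 ↦ 0). As 2^r divides m + 1, the i-th tent iterate is divisible
-- by 2^i for i ≤ r, so after r + 1 tent steps the value is 0 or an odd multiple of 2^r.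
-- The tent map preserves this finite set and is injective on it, since two odd multiples
-- of 2^r never add up to m + 1; hence it permutes the set, f^(r+2)(x) is periodic, and the
-- least periodic step is at most r + 2.
module Submission where

open import Defs
open import Data.Nat using (ℕ; zero; suc; _+_; _*_; _∸_; _^_; _≤_; _<_; _≤′_; ≤′-refl; ≤′-step; _⊔_; _⊓_; ∣_-_∣; z≤n; s≤s; s≤s⁻¹; NonZero)
open import Data.Nat.Properties
open import Data.Nat.DivMod using (_/_; _%_; m<n⇒m%n≡m; [m+kn]%n≡m%n; +-distrib-/-∣ʳ; m<n⇒m/n≡0; m*n/n≡m; m%n<n; m<n*o⇒m/o<n)
open import Data.Nat.Divisibility using (_∣_; divides; _∣0; 1∣_; n∣m*n; *-monoʳ-∣; m*n∣⇒n∣)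
open import Data.Nat.Tactic.RingSolver using (solve-∀)
open import Data.Fin using (toℕ; fromℕ<)
open import Data.Fin.Properties using (pigeonhole; fromℕ<-injective)
open import Data.Product using (Σ; _×_; _,_; ∃-syntax)
open import Data.Sum using (_⊎_; inj₁; inj₂)
open import Data.Empty using (⊥-elim)
open import Relation.Nullary using (¬_; Dec; yes; no)
open import Relation.Binary.PropositionalEquality using (_≡_; _≢_; refl; sym; trans; cong; cong₂; subst; module ≡-Reasoning)

module _ (f : ℕ → ℕ) where

  iter-+ : ∀ a b x → iter f (a + b) x ≡ iter f b (iter f a x)
  iter-+ a zero    x = cong (λ c → iter f c x) (+-identityʳ a)
  iter-+ a (suc b) x = trans (cong (λ c → iter f c x) (+-suc a b)) (cong f (iter-+ a b x))

  iter-comm : ∀ a b x → iter f a (iter f b x) ≡ iter f b (iter f a x)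
  iter-comm a b x = begin
    iter f a (iter f b x) ≡⟨ iter-+ b a x ⟨
    iter f (b + a) x      ≡⟨ cong (λ c → iter f c x) (+-comm b a) ⟩
    iter f (a + b) x      ≡⟨ iter-+ a b x ⟩
    iter f b (iter f a x) ∎
    where open ≡-Reasoning

  iter-cycle-* : ∀ {t y} → iter f t y ≡ y → ∀ k → iter f (k * t) y ≡ y
  iter-cycle-* cyc zero    = refl
  iter-cycle-* {t} {y} cyc (suc k) =
    trans (iter-+ t (k * t) y) (trans (cong (iter f (k * t)) cyc) (iter-cycle-* cyc k))

  iter-cycle-closed : ∀ {t z} → iter f t z ≡ z → ∀ a → iter f t (iter f a z) ≡ iter f a z
  iter-cycle-closed {t} {z} cyc a = trans (iter-comm t a z) (cong (iter f a) cyc)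

  periodic-intro : ∀ {x s t} → 1 ≤ t → iter f t (iter f s x) ≡ iter f s x → Periodic f x s
  periodic-intro {x} {s} {t} t≥1 cyc = t , t≥1 , trans (iter-+ s t x) cyc

  periodic-suc : ∀ {x s} → Periodic f x s → Periodic f x (suc s)
  periodic-suc (t , t≥1 , cyc) = t , t≥1 , cong f cyc

  periodic-mono : ∀ {x s s′} → s ≤′ s′ → Periodic f x s → Periodic f x s′
  periodic-mono ≤′-refl        p = p
  periodic-mono {x} (≤′-step {s′} s≤s′) p = periodic-suc {x} {s′} (periodic-mono s≤s′ p)

  periodic⇒shares-period : ∀ {x s₀ t₀ s} → iter f (s₀ + t₀) x ≡ iter f s₀ x →
                           Periodic f x s → iter f (s + t₀) x ≡ iter f s x
  periodic⇒shares-period {x} {s₀} {t₀} {s} per₀ (suc t , _ , per) = begin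
    iter f (s + t₀) x            ≡⟨ iter-+ s t₀ x ⟩
    iter f t₀ y                  ≡⟨ cong (iter f t₀) y≡ ⟩
    iter f t₀ (iter f (s + k) z) ≡⟨ iter-cycle-closed {t₀} {z} z-cycle (s + k) ⟩
    iter f (s + k) z             ≡⟨ y≡ ⟨
    y                            ∎
    where
    open ≡-Reasoning
    y z k : ℕ
    y = iter f s x
    z = iter f s₀ x
    k = t * s₀
    y-cycle : iter f (suc t) y ≡ y
    y-cycle = trans (sym (iter-+ s (suc t) x)) per
    z-cycle : iter f t₀ z ≡ z
    z-cycle = trans (sym (iter-+ s₀ t₀ x)) per₀
    y≡ : y ≡ iter f (s + k) z
    y≡ = begin
      y                      ≡⟨ iter-cycle-* {suc t} {y} y-cycle s₀ ⟨
      iter f (s₀ * suc t) y  ≡⟨ cong (λ c → iter f c y) (*-comm s₀ (suc t)) ⟩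
      iter f (s₀ + k) y      ≡⟨ iter-+ s₀ k y ⟩
      iter f k (iter f s₀ y) ≡⟨ cong (iter f k) (iter-comm s₀ s x) ⟩
      iter f k (iter f s z)  ≡⟨ iter-+ s k z ⟨
      iter f (s + k) z       ∎

  periodic? : ∀ {x s₀} → Periodic f x s₀ → ∀ s → Dec (Periodic f x s)
  periodic? {x} {s₀} (t₀ , t₀≥1 , per₀) s with iter f (s + t₀) x ≟ iter f s x
  ... | yes per = yes (t₀ , t₀≥1 , per)
  ... | no ¬per = no (λ p → ¬per (periodic⇒shares-period {x} {s₀} {t₀} {s} per₀ p))

  periodic⇒step : ∀ {x s₀} → Periodic f x s₀ → Σ ℕ λ s → IsStep f x s × s ≤ s₀
  periodic⇒step {x} {s₀} p₀ = search s₀ p₀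
    where
    search : ∀ s → Periodic f x s → Σ ℕ λ s′ → IsStep f x s′ × s′ ≤ s
    search zero    p = zero , (p , λ _ ()) , z≤n
    search (suc s) p with periodic? {x} {s₀} p₀ s
    ... | yes q = let s′ , step , s′≤s = search s q in s′ , step , m≤n⇒m≤1+n s′≤s
    ... | no ¬q = suc s , (p , λ s′ s′<1+s q′ → ¬q (periodic-mono {x} {s′} {s} (≤⇒≤′ (s≤s⁻¹ s′<1+s)) q′)) , ≤-refl

module _ (f : ℕ → ℕ) {S : ℕ → Set} (B : ℕ) (S⇒<B : ∀ {a} → S a → a < B)
         (f-closed : ∀ {a} → S a → S (f a))
         (f-injective : ∀ {a b} → S a → S b → f a ≡ f b → a ≡ b) where

  iter-closed : ∀ i {a} → S a → S (iter f i a)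
  iter-closed zero    Sa = Sa
  iter-closed (suc i) Sa = f-closed (iter-closed i Sa)

  iter-injective : ∀ i {a b} → S a → S b → iter f i a ≡ iter f i b → a ≡ b
  iter-injective zero    _  _  eq = eq
  iter-injective (suc i) Sa Sb eq =
    iter-injective i Sa Sb (f-injective (iter-closed i Sa) (iter-closed i Sb) eq)

  injective⇒recurrent : ∀ {y} → S y → ∃[ t ] 1 ≤ t × iter f t y ≡ y
  injective⇒recurrent {y} Sy with pigeonhole (n<1+n B) (λ i → fromℕ< (S⇒<B (iter-closed (toℕ i) Sy)))
  ... | i , j , i<j , eq with m≤n⇒∃[o]m+o≡n i<j
  ... | t , i+1+t≡j = suc t , s≤s z≤n , sym (iter-injective (toℕ i) Sy (iter-closed (suc t) Sy) (begin
    iter f (toℕ i) y                  ≡⟨ fromℕ<-injective _ _ _ _ eq ⟩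
    iter f (toℕ j) y                  ≡⟨ cong (λ c → iter f c y) (trans (+-suc (toℕ i) t) i+1+t≡j) ⟨
    iter f (toℕ i + suc t) y          ≡⟨ iter-+ f (toℕ i) (suc t) y ⟩
    iter f (suc t) (iter f (toℕ i) y) ≡⟨ iter-comm f (suc t) (toℕ i) y ⟩
    iter f (toℕ i) (iter f (suc t) y) ∎))
    where open ≡-Reasoning

∣m∣n⇒∣∣m-n∣ : ∀ {d m n} → d ∣ m → d ∣ n → d ∣ ∣ m - n ∣
∣m∣n⇒∣∣m-n∣ {d} (divides p refl) (divides q refl) = divides ∣ p - q ∣ (sym (*-distribʳ-∣-∣ d p q))

∣1+2m-2n∣-odd : ∀ m n → ∃[ v ] ∣ suc (2 * m) - 2 * n ∣ ≡ suc (2 * v)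
∣1+2m-2n∣-odd m       zero    = m , refl
∣1+2m-2n∣-odd zero    (suc n) = n , +-suc n (n + 0)
∣1+2m-2n∣-odd (suc m) (suc n) =
  let v , eq = ∣1+2m-2n∣-odd m n in
  v , trans (cong₂ (λ a b → ∣ suc a - b ∣) (*-suc 2 m) (*-suc 2 n)) eq

m∸n≡o∸m⇒n+o≡m+m : ∀ {q x y} → x ≤ q → q ≤ y → q ∸ x ≡ y ∸ q → x + y ≡ q + q
m∸n≡o∸m⇒n+o≡m+m {q} {x} {y} x≤q q≤y eq = begin
  x + y           ≡⟨ cong (x +_) (m∸n+n≡m q≤y) ⟨
  x + (y ∸ q + q) ≡⟨ cong (λ c → x + (c + q)) eq ⟨
  x + (q ∸ x + q) ≡⟨ +-assoc x (q ∸ x) q ⟨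
  x + (q ∸ x) + q ≡⟨ cong (_+ q) (m+[n∸m]≡n x≤q) ⟩
  q + q           ∎
  where open ≡-Reasoning

∣m-n∣≡∣m-o∣⇒n≡o⊎n+o≡m+m : ∀ q x y → ∣ q - x ∣ ≡ ∣ q - y ∣ → x ≡ y ⊎ x + y ≡ q + q
∣m-n∣≡∣m-o∣⇒n≡o⊎n+o≡m+m q x y eq with ≤-total x q | ≤-total y q
... | inj₁ x≤q | inj₁ y≤q = inj₁ (∸-cancelˡ-≡ x≤q y≤q
  (trans (sym (m≤n⇒∣n-m∣≡n∸m x≤q)) (trans eq (m≤n⇒∣n-m∣≡n∸m y≤q))))
... | inj₁ x≤q | inj₂ q≤y = inj₂ (m∸n≡o∸m⇒n+o≡m+m x≤q q≤y
  (trans (sym (m≤n⇒∣n-m∣≡n∸m x≤q)) (trans eq (m≤n⇒∣m-n∣≡n∸m q≤y))))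
... | inj₂ q≤x | inj₁ y≤q = inj₂ (trans (+-comm x y) (m∸n≡o∸m⇒n+o≡m+m y≤q q≤x
  (trans (sym (m≤n⇒∣n-m∣≡n∸m y≤q)) (trans (sym eq) (m≤n⇒∣m-n∣≡n∸m q≤x)))))
... | inj₂ q≤x | inj₂ q≤y = inj₁ (+-cancelʳ-≡ q x y (begin
  x + q         ≡⟨ cong (_+ q) (m∸n+n≡m q≤x) ⟨
  x ∸ q + q + q ≡⟨ cong (λ c → c + q + q) (trans (sym (m≤n⇒∣m-n∣≡n∸m q≤x)) (trans eq (m≤n⇒∣m-n∣≡n∸m q≤y))) ⟩
  y ∸ q + q + q ≡⟨ cong (_+ q) (m∸n+n≡m q≤y) ⟩
  y + q         ∎))
  where open ≡-Reasoning

tent : ℕ → ℕ → ℕ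
tent n zero    = 0
tent n (suc j) = ∣ n - 2 * suc j ∣

tent-split : ∀ j c → tent (2 + (j + c)) (suc j) ≡ ∣ c - j ∣
tent-split j c = trans (cong ∣ 2 + (j + c) -_∣ 2[1+j]≡2+j+j) (∣m+n-m+o∣≡∣n-o∣ (2 + j) c j)
  where
  2[1+j]≡2+j+j : 2 * suc j ≡ 2 + j + j
  2[1+j]≡2+j+j = trans (*-suc 2 j) (cong (λ a → 2 + (j + a)) (+-identityʳ j))

tent-≤ : ∀ {b k} → k ≤ b → tent (2 + b) k ≤ b
tent-≤ {k = zero}  _   = z≤n
tent-≤ {k = suc j} j<b with m≤n⇒∃[o]m+o≡n (<⇒≤ j<b)
... | c , refl = begin
  tent (2 + (j + c)) (suc j) ≡⟨ tent-split j c ⟩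
  ∣ c - j ∣                  ≤⟨ ∣m-n∣≤m⊔n c j ⟩
  c ⊔ j                      ≤⟨ m⊔n≤m+n c j ⟩
  c + j                      ≡⟨ +-comm c j ⟩
  j + c                      ∎
  where open ≤-Reasoning

iter-tent-≤ : ∀ {b k} i → k ≤ b → iter (tent (2 + b)) i k ≤ b
iter-tent-≤ zero    k≤b = k≤b
iter-tent-≤ (suc i) k≤b = tent-≤ (iter-tent-≤ i k≤b)

tent-∣ : ∀ {d n} k → d ∣ n → d ∣ 2 * k → d ∣ tent n k
tent-∣ zero    _   _    = _ ∣0
tent-∣ (suc j) d∣n d∣2k = ∣m∣n⇒∣∣m-n∣ d∣n d∣2k

iter-tent-∣ : ∀ {n} i k → 2 ^ i ∣ n → 2 ^ i ∣ iter (tent n) i k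
iter-tent-∣ zero    k _     = 1∣ k
iter-tent-∣ (suc i) k 2ⁱ⁺¹∣n =
  tent-∣ (iter (tent _) i k) 2ⁱ⁺¹∣n (*-monoʳ-∣ 2 (iter-tent-∣ i k (m*n∣⇒n∣ 2 (2 ^ i) 2ⁱ⁺¹∣n)))

OddMultiple : ℕ → ℕ → Set
OddMultiple p a = ∃[ w ] a ≡ suc (2 * w) * p

ZeroOrOddMultiple : ℕ → ℕ → Set
ZeroOrOddMultiple p a = a ≡ 0 ⊎ OddMultiple p a

module OddPart {n p : ℕ} .{{_ : NonZero p}} (Q : ℕ) (n≡ : n ≡ suc (2 * Q) * p) where

  tent-oddMultiple : ∀ j → p ∣ suc j → OddMultiple p (tent n (suc j))
  tent-oddMultiple j (divides w 1+j≡wp) with ∣1+2m-2n∣-odd Q w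
  ... | v , odd = v , (begin
    ∣ n - 2 * suc j ∣                   ≡⟨ cong₂ ∣_-_∣ n≡ (cong (2 *_) 1+j≡wp) ⟩
    ∣ suc (2 * Q) * p - 2 * (w * p) ∣   ≡⟨ cong ∣ suc (2 * Q) * p -_∣ (*-assoc 2 w p) ⟨
    ∣ suc (2 * Q) * p - 2 * w * p ∣     ≡⟨ *-distribʳ-∣-∣ p (suc (2 * Q)) (2 * w) ⟨
    ∣ suc (2 * Q) - 2 * w ∣ * p         ≡⟨ cong (_* p) odd ⟩
    suc (2 * v) * p                     ∎)
    where open ≡-Reasoning

  zeroOrOddMultiple⇒∣ : ∀ {a} → ZeroOrOddMultiple p a → p ∣ a
  zeroOrOddMultiple⇒∣ (inj₁ refl)       = p ∣0
  zeroOrOddMultiple⇒∣ (inj₂ (w , refl)) = n∣m*n (suc (2 * w))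

  tent-zeroOrOddMultiple : ∀ a → p ∣ a → ZeroOrOddMultiple p (tent n a)
  tent-zeroOrOddMultiple zero    _   = inj₁ refl
  tent-zeroOrOddMultiple (suc j) p∣a = inj₂ (tent-oddMultiple j p∣a)

  oddMultiple≢0 : ∀ {a} → OddMultiple p a → a ≢ 0
  oddMultiple≢0 (w , refl) eq with m*n≡0⇒m≡0 (suc (2 * w)) p eq
  ... | ()

  oddMultiple+oddMultiple≢n : ∀ {a b} → OddMultiple p a → OddMultiple p b → a + b ≢ n
  oddMultiple+oddMultiple≢n (w , refl) (v , refl) a+b≡n =
    even≢odd (suc (w + v)) Q (*-cancelʳ-≡ _ _ p (begin
      2 * suc (w + v) * p               ≡⟨ regroup w v p ⟩
      suc (2 * w) * p + suc (2 * v) * p ≡⟨ a+b≡n ⟩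
      n                                 ≡⟨ n≡ ⟩
      suc (2 * Q) * p                   ∎))
    where
    open ≡-Reasoning
    regroup : ∀ w v p → 2 * suc (w + v) * p ≡ suc (2 * w) * p + suc (2 * v) * p
    regroup = solve-∀

  tent-injective : ∀ {a b} → ZeroOrOddMultiple p a → ZeroOrOddMultiple p b → tent n a ≡ tent n b → a ≡ b
  tent-injective {zero}  {zero}  _  _  _  = refl
  tent-injective {zero}  {suc j} _  hb eq =
    ⊥-elim (oddMultiple≢0 (tent-oddMultiple j (zeroOrOddMultiple⇒∣ hb)) (sym eq))
  tent-injective {suc i} {zero}  ha _  eq =
    ⊥-elim (oddMultiple≢0 (tent-oddMultiple i (zeroOrOddMultiple⇒∣ ha)) eq)
  tent-injective {suc i} {suc j} (inj₂ ha) (inj₂ hb) eq with ∣m-n∣≡∣m-o∣⇒n≡o⊎n+o≡m+m n (2 * suc i) (2 * suc j) eq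
  ... | inj₁ 2a≡2b     = *-cancelˡ-≡ (suc i) (suc j) 2 2a≡2b
  ... | inj₂ 2a+2b≡n+n = ⊥-elim (oddMultiple+oddMultiple≢n ha hb (*-cancelˡ-≡ _ _ 2 (begin
    2 * (suc i + suc j)     ≡⟨ *-distribˡ-+ 2 (suc i) (suc j) ⟩
    2 * suc i + 2 * suc j   ≡⟨ 2a+2b≡n+n ⟩
    n + n                   ≡⟨ cong (n +_) (+-identityʳ n) ⟨
    2 * n                   ∎)))
    where open ≡-Reasoning

kaprekar-difference : ∀ b {l u} → l ≤ u → (suc b * u + l) ∸ (suc b * l + u) ≡ b * (u ∸ l)
kaprekar-difference b {l} l≤u with m≤n⇒∃[o]m+o≡n l≤u
... | d , refl = begin
  (suc b * (l + d) + l) ∸ (suc b * l + (l + d))         ≡⟨ cong (_∸ (suc b * l + (l + d))) (regroup b l d) ⟩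
  (suc b * l + (l + d)) + b * d ∸ (suc b * l + (l + d)) ≡⟨ m+n∸m≡n (suc b * l + (l + d)) (b * d) ⟩
  b * d                                                 ≡⟨ cong (b *_) (m+n∸m≡n l d) ⟨
  b * (l + d ∸ l)                                       ∎
  where
  open ≡-Reasoning
  regroup : ∀ b l d → suc b * (l + d) + l ≡ (suc b * l + (l + d)) + b * d
  regroup = solve-∀

kaprekar-gap : ∀ b d₀ d₁ →
  (suc b * (d₀ ⊔ d₁) + (d₀ ⊓ d₁)) ∸ (suc b * (d₀ ⊓ d₁) + (d₀ ⊔ d₁)) ≡ b * ∣ d₀ - d₁ ∣
kaprekar-gap b d₀ d₁ with ≤-total d₀ d₁
... | inj₁ d₀≤d₁ rewrite m≤n⇒m⊔n≡n d₀≤d₁ | m≤n⇒m⊓n≡m d₀≤d₁ | m≤n⇒∣m-n∣≡n∸m d₀≤d₁ =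
  kaprekar-difference b d₀≤d₁
... | inj₂ d₁≤d₀ rewrite m≥n⇒m⊔n≡m d₁≤d₀ | m≥n⇒m⊓n≡n d₁≤d₀ | m≤n⇒∣n-m∣≡n∸m d₁≤d₀ =
  kaprekar-difference b d₁≤d₀

kap-digits : ∀ b x → kap (suc b) x ≡ b * ∣ x % suc b - x / suc b ∣
kap-digits b x = kaprekar-gap b (x % suc b) (x / suc b)

digit-gap-≤ : ∀ b x → x < suc b * suc b → ∣ x % suc b - x / suc b ∣ ≤ b
digit-gap-≤ b x x<m² = ≤-trans (∣m-n∣≤m⊔n (x % suc b) (x / suc b))
  (⊔-lub (s≤s⁻¹ (m%n<n x (suc b))) (s≤s⁻¹ (m<n*o⇒m/o<n x<m²)))

module _ {m : ℕ} .{{_ : NonZero m}} (d₁ : ℕ) {d₀ : ℕ} (d₀<m : d₀ < m) where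

  %-low-digit : (d₀ + d₁ * m) % m ≡ d₀
  %-low-digit = trans ([m+kn]%n≡m%n d₀ d₁ m) (m<n⇒m%n≡m d₀<m)

  /-high-digit : (d₀ + d₁ * m) / m ≡ d₁
  /-high-digit = begin
    (d₀ + d₁ * m) / m     ≡⟨ +-distrib-/-∣ʳ d₀ (n∣m*n d₁) ⟩
    d₀ / m + d₁ * m / m   ≡⟨ cong₂ _+_ (m<n⇒m/n≡0 d₀<m) (m*n/n≡m d₁ m) ⟩
    d₁                    ∎
    where open ≡-Reasoning

kap-multiple : ∀ {b k} → k ≤ b → kap (suc b) (b * k) ≡ b * tent (2 + b) k
kap-multiple {b} {zero} _ = trans (cong (kap (suc b)) (*-zeroʳ b)) (kap-digits b 0)
kap-multiple {k = suc j} j<b with m≤n⇒∃[o]m+o≡n (<⇒≤ j<b)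
... | c , refl = begin
  kap m ((j + c) * suc j)                         ≡⟨ cong (kap m) (regroup j c) ⟩
  kap m (c + j * m)                               ≡⟨ kap-digits (j + c) (c + j * m) ⟩
  (j + c) * ∣ (c + j * m) % m - (c + j * m) / m ∣ ≡⟨ cong₂ (λ d₀ d₁ → (j + c) * ∣ d₀ - d₁ ∣) (%-low-digit j c<m) (/-high-digit j c<m) ⟩
  (j + c) * ∣ c - j ∣                             ≡⟨ cong ((j + c) *_) (tent-split j c) ⟨
  (j + c) * tent (2 + (j + c)) (suc j)            ∎
  where
  open ≡-Reasoning
  m = suc (j + c)
  c<m : c < m
  c<m = s≤s (m≤n+m c j)
  regroup : ∀ j c → (j + c) * suc j ≡ c + j * suc (j + c)
  regroup = solve-∀

kap-iter-multiple : ∀ {b k} t → k ≤ b → iter (kap (suc b)) t (b * k) ≡ b * iter (tent (2 + b)) t k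
kap-iter-multiple zero    _   = refl
kap-iter-multiple (suc t) k≤b =
  trans (cong (kap _) (kap-iter-multiple t k≤b)) (kap-multiple (iter-tent-≤ t k≤b))

even-or-odd : ∀ q → (∃[ h ] q ≡ 2 * h) ⊎ (∃[ h ] q ≡ suc (2 * h))
even-or-odd zero    = inj₁ (0 , refl)
even-or-odd (suc q) with even-or-odd q
... | inj₁ (h , refl) = inj₂ (h , refl)
... | inj₂ (h , refl) = inj₁ (suc h , sym (*-suc 2 h))

odd-part : ∀ {n} r → 2 ^ r ∣ n → ¬ (2 ^ (r + 1) ∣ n) → ∃[ Q ] n ≡ suc (2 * Q) * 2 ^ r
odd-part {n} r (divides q n≡q2ʳ) 2ʳ⁺¹∤n with even-or-odd q
... | inj₂ (Q , refl) = Q , n≡q2ʳ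
... | inj₁ (h , refl) = ⊥-elim (2ʳ⁺¹∤n (divides h (begin
  n               ≡⟨ n≡q2ʳ ⟩
  2 * h * 2 ^ r   ≡⟨ regroup h (2 ^ r) ⟩
  h * (2 * 2 ^ r) ≡⟨ cong (λ e → h * 2 ^ e) (+-comm 1 r) ⟩
  h * 2 ^ (r + 1) ∎)))
  where
  open ≡-Reasoning
  regroup : ∀ h p → 2 * h * p ≡ h * (2 * p)
  regroup = solve-∀

tent-recurrent : ∀ {b p} .{{_ : NonZero p}} (Q : ℕ) → 2 + b ≡ suc (2 * Q) * p →
  ∀ {y} → y ≤ b → ZeroOrOddMultiple p y → ∃[ t ] 1 ≤ t × iter (tent (2 + b)) t y ≡ y
tent-recurrent {b} {p} Q n≡ y≤b hy =
  injective⇒recurrent (tent (2 + b)) {S = λ a → a ≤ b × ZeroOrOddMultiple p a} (suc b)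
    (λ (a≤b , _) → s≤s a≤b)
    (λ (a≤b , ha) → tent-≤ a≤b , tent-zeroOrOddMultiple _ (zeroOrOddMultiple⇒∣ ha))
    (λ (_ , ha) (_ , hb) → tent-injective ha hb)
    (y≤b , hy)
  where open OddPart Q n≡

kap-cycle : ∀ {b k} t → k ≤ b → iter (tent (2 + b)) t k ≡ k → iter (kap (suc b)) t (b * k) ≡ b * k
kap-cycle {b} t k≤b cyc = trans (kap-iter-multiple t k≤b) (cong (b *_) cyc)

kap-periodic : ∀ b r Q → 2 + b ≡ suc (2 * Q) * 2 ^ r →
  ∀ x → x < suc b * suc b → Periodic (kap (suc b)) x (2 + r)
kap-periodic b r Q n≡ x x<m² =
  let t , t≥1 , y-cycle = tent-recurrent Q n≡ y≤b y-zeroOrOddMultiple in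
  periodic-intro (kap (suc b)) {x} {2 + r} t≥1 (begin
    iter (kap (suc b)) t z       ≡⟨ cong (iter (kap (suc b)) t) z≡by ⟩
    iter (kap (suc b)) t (b * y) ≡⟨ kap-cycle t y≤b y-cycle ⟩
    b * y                        ≡⟨ z≡by ⟨
    z                            ∎)
  where
  open ≡-Reasoning
  instance
    2ʳ≢0 : NonZero (2 ^ r)
    2ʳ≢0 = m^n≢0 2 r
  open OddPart Q n≡
  k y z : ℕ
  k = ∣ x % suc b - x / suc b ∣
  y = iter (tent (2 + b)) (suc r) k
  z = iter (kap (suc b)) (2 + r) x
  k≤b : k ≤ b
  k≤b = digit-gap-≤ b x x<m²
  y≤b : y ≤ b
  y≤b = iter-tent-≤ (suc r) k≤b
  y-zeroOrOddMultiple : ZeroOrOddMultiple (2 ^ r) y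
  y-zeroOrOddMultiple = tent-zeroOrOddMultiple (iter (tent (2 + b)) r k) (iter-tent-∣ r k (divides (suc (2 * Q)) n≡))
  z≡by : z ≡ b * y
  z≡by = trans (iter-+ (kap (suc b)) 1 (suc r) x)
               (trans (cong (iter (kap (suc b)) (suc r)) (kap-digits b x)) (kap-iter-multiple (suc r) k≤b))

theorem3p4p1 : (m : ℕ) .{{_ : NonZero m}} → 2 ≤ m →
    (r : ℕ) → 2 ^ r ∣ m + 1 → ¬ (2 ^ (r + 1) ∣ m + 1) →
    (x : ℕ) → x < m * m →
      Σ ℕ (λ s → IsStep (kap m) x s × (s ≤ r + 2))
theorem3p4p1 (suc b) _ r 2ʳ∣m+1 2ʳ⁺¹∤m+1 x x<m²
  with odd-part r (subst (2 ^ r ∣_) (+-comm (suc b) 1) 2ʳ∣m+1)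
                  (λ 2ʳ⁺¹∣n → 2ʳ⁺¹∤m+1 (subst (2 ^ (r + 1) ∣_) (+-comm 1 (suc b)) 2ʳ⁺¹∣n))
... | Q , n≡ = periodic⇒step (kap (suc b)) (subst (Periodic (kap (suc b)) x) (+-comm 2 r) (kap-periodic b r Q n≡ x x<m²))
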